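{- Let $T=(S,A)$ be a $(-1)$-critical tournament with non-critical vertex $a$. Let $C$ be the unique connected component of $I(T)$ with at least two vertices, and suppose $C=\{0,\dots,m\}\subseteq S$ is labelled so that the subgraph of $I(T)$ induced on $C$ is the path $P_{m+1}$ (edges $\{i,i+1\}$, $0\le i\le m-1$). Put $A_I^+=\{i\in C: i>a,\ i\text{ odd}\}$, $A_I^-=\{i\in C: i<a,\ i\text{ odd}\}$, $A_P^+=\{i\in C: i>a,\ i\text{ even}\}$, $A_P^-=\{i\in C: i<a,\ i\text{ even}\}$. If $W$ is one of $T(A_P^+)$, $T(A_P^-)$, $T(A_I^+)$, $T(A_I^-)$, then either $W$ or $W^*$ is the usual total order on its vertex set, i.e. either $i\to j$ for all $i<j$ in $S(W)$, or $j\to i$ for all $i<j$ in $S(W)$.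
   Context: A tournament $T=(S,A)$ consists of a finite set $S$ and a set $A$ of ordered pairs of distinct elements of $S$ such that for all distinct $x,y\in S$ exactly one of $(x,y),(y,x)$ lies in $A$; write $x\to y$ for $(x,y)\in A$. For $X\subseteq S$, $T(X)$ is the induced subtournament, $T-X=T(S\setminus X)$, $T-x=T(S\setminus\{x\})$; $T^*$ is the dual tournament obtained by reversing all arcs. A subset $I\subseteq S$ is an interval of $T$ if for all $a,b\in I$ and $x\in S\setminus I$, $(a,x)\in A$ iff $(b,x)\in A$. The sets $\emptyset$, $\{x\}$ and $S$ are the trivial intervals; $T$ is indecomposable if all its intervals are trivial, and decomposable otherwise. A vertex $x$ of an indecomposable tournament $T$ is critical if $T-x$ is decomposable. An indecomposable tournament with at least $5$ vertices is $(-1)$-critical if exactly one of its vertices is non-critical. The indecomposability graph $I(T)$ is the undirected graph on $S$ in which distinct $x,y$ are adjacent iff $T-\{x,y\}$ is indecomposable; for $(-1)$-critical $T$ it has exactly one connected component with at least two vertices. -}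

module Defs where

open import Data.Nat using (ℕ; suc; _≤_; _<_; _%_)
open import Data.Fin using (Fin; toℕ)
open import Data.Fin.Subset using (Subset; _∈_; _∉_; _⊆_; ⊥; ⊤; ⁅_⁆; _-_)
open import Data.Bool using (Bool; true; false; not)
open import Data.Product using (_×_; ∃)
open import Data.Sum using (_⊎_)
open import Relation.Binary.PropositionalEquality using (_≡_; _≢_)
open import Relation.Nullary using (¬_)

-- A tournament on the vertex set S = Fin n; arc x y ≡ true means x → y.
record Tournament (n : ℕ) : Set where
  field
    arc    : Fin n → Fin n → Bool
    irrefl : ∀ x → arc x x ≡ false
    tourn  : ∀ x y → x ≢ y → arc x y ≡ not (arc y x)
open Tournament public

module _ {n : ℕ} (T : Tournament n) where

  IsInterval : Subset n → Subset n → Set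
  IsInterval X I = I ⊆ X × (∀ a b x → a ∈ I → b ∈ I → x ∈ X → x ∉ I → arc T a x ≡ arc T b x)

  Trivial : Subset n → Subset n → Set
  Trivial X I = I ≡ ⊥ ⊎ (∃ λ x → I ≡ ⁅ x ⁆) ⊎ I ≡ X

  Indecomposable : Subset n → Set
  Indecomposable X = ∀ I → IsInterval X I → Trivial X I

  Decomposable : Subset n → Set
  Decomposable X = ¬ Indecomposable X

  Critical : Fin n → Set
  Critical x = Indecomposable ⊤ × Decomposable (⊤ - x)

  MinusOneCritical : Fin n → Set
  MinusOneCritical a =
    5 ≤ n × Indecomposable ⊤ × ¬ Critical a × (∀ x → x ≢ a → Critical x)

  IAdj : Fin n → Fin n → Set
  IAdj x y = x ≢ y × Indecomposable ((⊤ - x) - y)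

  TotalOrderOrDual : (Fin n → Set) → Set
  TotalOrderOrDual W =
      (∀ i j → W i → W j → toℕ i < toℕ j → arc T i j ≡ true)
    ⊎ (∀ i j → W i → W j → toℕ i < toℕ j → arc T j i ≡ true)

InC : {n : ℕ} → ℕ → Fin n → Set
InC m x = toℕ x ≤ m

-- A_I^+ (above = true, parity 1), A_I^- (above = false, parity 1),
-- A_P^+ (above = true, parity 0), A_P^- (above = false, parity 0)
Block : {n : ℕ} → ℕ → Fin n → Bool → ℕ → Fin n → Set
Block m a true  par i = InC m i × toℕ a < toℕ i × toℕ i % 2 ≡ par
Block m a false par i = InC m i × toℕ i < toℕ a × toℕ i % 2 ≡ par

-- If x is critical while T − {u, x} and T − {x, v} are indecomposable, then u and v are twins
-- in T − x: a vertex w separating them would make every interval of T − x trivial, as one sees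
-- by restricting the interval to T − x − v and to T − x − u. Along the path C every vertex other
-- than a is critical, so i and i + 2 are twins whenever i + 1 ≠ a. Consecutive members of each
-- of the four blocks are such pairs, hence sliding an endpoint of an arc along its block never
-- changes the arc's direction, and all arcs inside a block point the same way.

module Submission where

open import Defs
open import Data.Nat using (ℕ; zero; suc; _+_; _≤_; _<_; _%_; s≤s; _≤?_; _<?_)
import Data.Nat as ℕ
open import Data.Nat.Properties
  using (≤-trans; ≤-total; <-trans; <-≤-trans; ≤-<-trans; ≤∧≢⇒<; <⇒≤; n<1+n; m<n⇒m<1+n; m≤n⇒m<n∨m≡n)
open import Data.Nat.Induction using (<-wellFounded)
open import Induction.WellFounded using (Acc; acc)
open import Data.Fin using (Fin; toℕ; fromℕ<; _≟_)
open import Data.Fin.Properties using (toℕ-injective; toℕ-fromℕ<; toℕ<n; <⇒≢; any?; pigeonhole)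
open import Data.Fin.Subset using (Subset; _∈_; _∉_; _⊆_; _─_; _-_; _∩_; ⊤; ⁅_⁆; inside; outside)
open import Data.Fin.Subset.Properties
  using ( ∈⊤; ∉⊥; x∈⁅x⁆; x∈⁅y⁆⇒x≡y; ⊆-antisym; ⊆-min; x∈p∩q⁺; x∈p∩q⁻; p─q⊆p
        ; x∈p∧x≢y⇒x∈p-y; p─x─y≡p─y─x; _∈?_)
open import Data.Bool using (Bool; true; false; not)
import Data.Bool.Properties as Bool
open import Data.Empty using (⊥-elim) renaming (⊥ to ∅)
open import Data.List using (List; []; _∷_; length; lookup)
open import Data.List.Membership.Propositional using () renaming (_∈_ to _∈ₗ_)
open import Data.List.Relation.Unary.All using (All; []; _∷_)
open import Data.List.Relation.Unary.All.Properties using (¬Any⇒All¬)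
import Data.List.Membership.DecPropositional as DecMembership
import Data.List.Relation.Unary.Any as Any
open import Data.List.Relation.Unary.Any.Properties using (lookup-index)
open import Data.Product using (_×_; _,_; proj₁; proj₂; ∃)
open import Data.Sum using (_⊎_; inj₁; inj₂)
open import Data.Vec using (_∷_; here; there)
open import Relation.Binary.PropositionalEquality
  using (_≡_; _≢_; ≢-sym; refl; sym; trans; cong; subst; subst₂; module ≡-Reasoning)
open import Function using (case_of_)
open import Relation.Nullary using (¬_; Dec; yes; no; contradiction)
open import Relation.Nullary.Decidable using (¬?; decidable-stable; _×-dec_)
open import Relation.Unary using (Decidable)

x∈p─q⇒x∉q : ∀ {n} {p q : Subset n} {x : Fin n} → x ∈ p ─ q → x ∉ q
x∈p─q⇒x∉q {p = inside ∷ _} {outside ∷ _} here ()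
x∈p─q⇒x∉q {p = _ ∷ _} {_ ∷ _} (there x∈p─q) (there x∈q) = x∈p─q⇒x∉q x∈p─q x∈q

x∈p-y⇒x≢y : ∀ {n} {p : Subset n} {x y : Fin n} → x ∈ p - y → x ≢ y
x∈p-y⇒x≢y x∈p-y refl = x∈p─q⇒x∉q x∈p-y (x∈⁅x⁆ _)

module _ {n : ℕ} where
  open DecMembership (_≟_ {n}) using () renaming (_∈?_ to _∈ₗ?_)

  ∃-avoiding : (xs : List (Fin n)) → length xs < n → ∃ λ y → All (y ≢_) xs
  ∃-avoiding xs |xs|<n with any? (λ y → ¬? (y ∈ₗ? xs))
  ... | yes (y , y∉xs) = y , ¬Any⇒All¬ xs y∉xs
  ... | no none =
    let i , j , i<j , same-index = pigeonhole |xs|<n (λ y → Any.index (everywhere y))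
    in contradiction (index-injective same-index) (<⇒≢ i<j)
    where
    everywhere : ∀ y → y ∈ₗ xs
    everywhere y = decidable-stable (y ∈ₗ? xs) (λ y∉xs → none (y , y∉xs))
    index-injective : ∀ {i j} → Any.index (everywhere i) ≡ Any.index (everywhere j) → i ≡ j
    index-injective same = trans (lookup-index (everywhere _))
      (trans (cong (lookup xs) same) (sym (lookup-index (everywhere _))))

module _ {n : ℕ} (T : Tournament n) where

  ∩-isInterval : ∀ {X Y I : Subset n} → IsInterval T X I → Y ⊆ X → IsInterval T Y (I ∩ Y)
  ∩-isInterval {Y = Y} {I} (I⊆X , homogeneous) Y⊆X =
      (λ z∈I∩Y → proj₂ (x∈p∩q⁻ I Y z∈I∩Y))
    , λ a b x a∈ b∈ x∈Y x∉I∩Y →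
        homogeneous a b x (proj₁ (x∈p∩q⁻ I Y a∈)) (proj₁ (x∈p∩q⁻ I Y b∈)) (Y⊆X x∈Y)
          (λ x∈I → x∉I∩Y (x∈p∩q⁺ (x∈I , x∈Y)))

  ⊆⁅⁆⇒trivial : ∀ {X I : Subset n} {y : Fin n} → I ⊆ ⁅ y ⁆ → Trivial T X I
  ⊆⁅⁆⇒trivial {I = I} {y} I⊆⁅y⁆ with y ∈? I
  ... | yes y∈I =
    inj₂ (inj₁ (y , ⊆-antisym I⊆⁅y⁆ λ z∈⁅y⁆ → subst (_∈ I) (sym (x∈⁅y⁆⇒x≡y y z∈⁅y⁆)) y∈I))
  ... | no y∉I = inj₁ (⊆-antisym (λ z∈I → ⊥-elim (y∉I (y∈I z∈I))) (⊆-min I))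
    where
    y∈I : ∀ {z} → z ∈ I → y ∈ I
    y∈I z∈I = subst (_∈ I) (x∈⁅y⁆⇒x≡y y (I⊆⁅y⁆ z∈I)) z∈I

  separated⇒indecomposable : ∀ {X : Subset n} {u v w p q : Fin n}
    → Indecomposable T (X - u) → Indecomposable T (X - v)
    → u ≢ v → v ∈ X → w ∈ X - u - v → p ∈ X - u - v → q ∈ X - u - v → p ≢ q
    → arc T u w ≢ arc T v w → Indecomposable T X
  separated⇒indecomposable {X} {u} {v} {w} {p} {q}
    X-u-indec X-v-indec u≢v v∈X w∈ p∈ q∈ p≢q separates I I-interval@(I⊆X , homogeneous) =
    trivial (X-v-indec J (∩-isInterval I-interval (p─q⊆p X _))) (v ∈? I)
    where
    J K : Subset n
    J = I ∩ (X - v)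
    K = I ∩ (X - u)

    toJ : ∀ {z} → z ∈ I → z ≢ v → z ∈ J
    toJ z∈I z≢v = x∈p∩q⁺ (z∈I , x∈p∧x≢y⇒x∈p-y (I⊆X z∈I) z≢v)
    fromJ : ∀ {z} → z ∈ J → z ∈ I
    fromJ z∈J = proj₁ (x∈p∩q⁻ I _ z∈J)
    toK : ∀ {z} → z ∈ I → z ≢ u → z ∈ K
    toK z∈I z≢u = x∈p∩q⁺ (z∈I , x∈p∧x≢y⇒x∈p-y (I⊆X z∈I) z≢u)
    fromK : ∀ {z} → z ∈ K → z ∈ I
    fromK z∈K = proj₁ (x∈p∩q⁻ I _ z∈K)

    K-trivial : Trivial T (X - u) K
    K-trivial = X-u-indec K (∩-isInterval I-interval (p─q⊆p X _))

    module Rest {z} (z∈ : z ∈ X - u - v) where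
      ∈X-u : z ∈ X - u
      ∈X-u = p─q⊆p _ _ z∈
      ∈X : z ∈ X
      ∈X = p─q⊆p _ _ ∈X-u
      ≢u : z ≢ u
      ≢u = x∈p-y⇒x≢y ∈X-u
      ≢v : z ≢ v
      ≢v = x∈p-y⇒x≢y z∈
      ∈X-v : z ∈ X - v
      ∈X-v = x∈p∧x≢y⇒x∈p-y ∈X ≢v

    ∈-singleton : ∀ {L : Subset n} {y z} → L ≡ ⁅ y ⁆ → z ∈ L → z ≡ y
    ∈-singleton L≡⁅y⁆ z∈L = x∈⁅y⁆⇒x≡y _ (subst (_ ∈_) L≡⁅y⁆ z∈L)

    -- The shapes I = {y, v} and I = X − v are excluded by restricting I to X − u as well.
    no-pair : ∀ {y} → J ≡ ⁅ y ⁆ → v ∈ I → ∅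
    no-pair {y} J≡⁅y⁆ v∈I = cases (y ≟ u) K-trivial
      where
      y∈J = subst (y ∈_) (sym J≡⁅y⁆) (x∈⁅x⁆ y)
      y∈I = fromJ y∈J
      v∈K = toK v∈I (≢-sym u≢v)
      ≡y : ∀ {z} → z ∈ I → z ≢ v → z ≡ y
      ≡y z∈I z≢v = ∈-singleton J≡⁅y⁆ (toJ z∈I z≢v)

      cases : Dec (y ≡ u) → Trivial T (X - u) K → ∅
      cases (yes y≡u) _ = separates (homogeneous u v w u∈I v∈I (Rest.∈X w∈) w∉I)
        where
        u∈I = subst (_∈ I) y≡u y∈I
        w∉I = λ w∈I → Rest.≢u w∈ (trans (≡y w∈I (Rest.≢v w∈)) y≡u)
      cases (no _) (inj₁ K≡⊥) = ∉⊥ (subst (v ∈_) K≡⊥ v∈K)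
      cases (no y≢u) (inj₂ (inj₁ (_ , K≡⁅z⁆))) =
        x∈p-y⇒x≢y (proj₂ (x∈p∩q⁻ I _ y∈J))
          (trans (∈-singleton K≡⁅z⁆ (toK y∈I y≢u)) (sym (∈-singleton K≡⁅z⁆ v∈K)))
      cases (no _) (inj₂ (inj₂ K≡X-u)) = p≢q (trans (rest≡y p∈) (sym (rest≡y q∈)))
        where
        rest≡y : ∀ {r} → r ∈ X - u - v → r ≡ y
        rest≡y r∈ = ≡y (fromK (subst (_ ∈_) (sym K≡X-u) (Rest.∈X-u r∈))) (Rest.≢v r∈)

    no-co-singleton : J ≡ X - v → v ∉ I → ∅
    no-co-singleton J≡X-v v∉I = cases K-trivial
      where
      rest⊆K : ∀ {z} → z ∈ X - u - v → z ∈ K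
      rest⊆K z∈ = toK (fromJ (subst (_ ∈_) (sym J≡X-v) (Rest.∈X-v z∈))) (Rest.≢u z∈)

      cases : Trivial T (X - u) K → ∅
      cases (inj₁ K≡⊥) = ∉⊥ (subst (p ∈_) K≡⊥ (rest⊆K p∈))
      cases (inj₂ (inj₁ (_ , K≡⁅z⁆))) =
        p≢q (trans (∈-singleton K≡⁅z⁆ (rest⊆K p∈)) (sym (∈-singleton K≡⁅z⁆ (rest⊆K q∈))))
      cases (inj₂ (inj₂ K≡X-u)) =
        v∉I (fromK (subst (v ∈_) (sym K≡X-u) (x∈p∧x≢y⇒x∈p-y v∈X (≢-sym u≢v))))

    trivial : Trivial T (X - v) J → Dec (v ∈ I) → Trivial T X I
    trivial (inj₁ J≡⊥) _ = ⊆⁅⁆⇒trivial λ {z} z∈I → case z ≟ v of λ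
      { (yes z≡v) → subst (_∈ ⁅ v ⁆) (sym z≡v) (x∈⁅x⁆ v)
      ; (no z≢v) → contradiction (subst (z ∈_) J≡⊥ (toJ z∈I z≢v)) ∉⊥ }
    trivial (inj₂ (inj₁ (y , J≡⁅y⁆))) (no v∉I) = ⊆⁅⁆⇒trivial λ {z} z∈I →
      subst (z ∈_) J≡⁅y⁆ (toJ z∈I λ { refl → v∉I z∈I })
    trivial (inj₂ (inj₁ (_ , J≡⁅y⁆))) (yes v∈I) = ⊥-elim (no-pair J≡⁅y⁆ v∈I)
    trivial (inj₂ (inj₂ J≡X-v)) (yes v∈I) = inj₂ (inj₂ (⊆-antisym I⊆X λ {z} z∈X →
      case z ≟ v of λ
        { (yes z≡v) → subst (_∈ I) (sym z≡v) v∈I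
        ; (no z≢v) → fromJ (subst (z ∈_) (sym J≡X-v) (x∈p∧x≢y⇒x∈p-y z∈X z≢v)) }))
    trivial (inj₂ (inj₂ J≡X-v)) (no v∉I) = ⊥-elim (no-co-singleton J≡X-v v∉I)

  critical-twins : 5 ≤ n → ∀ {u x v w} → Decomposable T (⊤ - x) → IAdj T u x → IAdj T x v
    → u ≢ v → w ≢ u → w ≢ x → w ≢ v → arc T u w ≡ arc T v w
  critical-twins 5≤n {u} {x} {v} {w} T-x-decomposable (_ , T-u-x-indec) (x≢v , T-x-v-indec)
    u≢v w≢u w≢x w≢v
    with arc T u w Bool.≟ arc T v w
  ... | yes same = same
  ... | no separates with ∃-avoiding (u ∷ x ∷ v ∷ []) (<⇒≤ 5≤n)
  ... | p , p≢u ∷ p≢x ∷ p≢v ∷ [] with ∃-avoiding (p ∷ u ∷ x ∷ v ∷ []) 5≤n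
  ... | q , q≢p ∷ q≢u ∷ q≢x ∷ q≢v ∷ [] = contradiction
          (separated⇒indecomposable T-x-u-indec T-x-v-indec u≢v
            (x∈p∧x≢y⇒x∈p-y ∈⊤ (≢-sym x≢v)) (rest w≢x w≢u w≢v)
            (rest p≢x p≢u p≢v) (rest q≢x q≢u q≢v) (≢-sym q≢p) separates)
          T-x-decomposable
    where
    T-x-u-indec : Indecomposable T (⊤ - x - u)
    T-x-u-indec = subst (Indecomposable T) (p─x─y≡p─y─x ⊤ u x) T-u-x-indec
    rest : ∀ {z} → z ≢ x → z ≢ u → z ≢ v → z ∈ ⊤ - x - u - v
    rest z≢x z≢u z≢v = x∈p∧x≢y⇒x∈p-y (x∈p∧x≢y⇒x∈p-y (x∈p∧x≢y⇒x∈p-y ∈⊤ z≢x) z≢u) z≢v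

suc-%2≢ : ∀ k → suc k % 2 ≢ k % 2
suc-%2≢ zero ()
suc-%2≢ (suc k) eq = suc-%2≢ k (sym eq)

%2-gap : ∀ {a b} → a % 2 ≡ b % 2 → a < b → suc a < b
%2-gap {a} a≡b a<b with m≤n⇒m<n∨m≡n a<b
... | inj₁ 1+a<b = 1+a<b
... | inj₂ refl = contradiction (sym a≡b) (suc-%2≢ a)

2+-peel : ∀ {a b} → suc a < b → ∃ λ k → b ≡ 2 + k × a ≤ k
2+-peel {b = suc (suc k)} (s≤s (s≤s a≤k)) = k , refl , a≤k

<2+ : ∀ {a b} → b ≡ 2 + a → a < b
<2+ refl = m<n⇒m<1+n (n<1+n _)

module StepTwoChain {n : ℕ} (T : Tournament n) {W : Fin n → Set}
  (parity : ∀ {i j} → W i → W j → toℕ i % 2 ≡ toℕ j % 2)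
  (convex : ∀ {i j k} → W i → W k → toℕ i ≤ toℕ j → toℕ j ≤ toℕ k → toℕ j % 2 ≡ toℕ i % 2
           → W j)
  (twins : ∀ {i j w} → W i → W j → W w → toℕ j ≡ 2 + toℕ i → w ≢ i → w ≢ j
         → arc T i w ≡ arc T j w)
  where

  predecessor : ∀ {i j} → W i → W j → toℕ i < toℕ j
              → ∃ λ j' → W j' × toℕ j ≡ 2 + toℕ j' × toℕ i ≤ toℕ j'
  predecessor {i} {j} wi wj i<j with 2+-peel (%2-gap (parity wi wj) i<j)
  ... | k , j≡2+k , i≤k with fromℕ< (k<n j≡2+k) | toℕ-fromℕ< (k<n j≡2+k)
    where k<n = λ j≡2+k → <-trans (<2+ j≡2+k) (toℕ<n j)
  ... | j' | refl =
    j' , convex wi wj i≤k (<⇒≤ (<2+ j≡2+k)) (sym (trans (parity wi wj) (cong (_% 2) j≡2+k)))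
       , j≡2+k , i≤k

  twinsˡ : ∀ {i j w} → W i → W j → W w → toℕ j ≡ 2 + toℕ i → w ≢ i → w ≢ j
         → arc T w i ≡ arc T w j
  twinsˡ {i} {j} {w} wi wj ww j≡2+i w≢i w≢j = begin
    arc T w i        ≡⟨ tourn T w i w≢i ⟩
    not (arc T i w)  ≡⟨ cong not (twins wi wj ww j≡2+i w≢i w≢j) ⟩
    not (arc T j w)  ≡⟨ tourn T w j w≢j ⟨
    arc T w j        ∎
    where open ≡-Reasoning

  slideʳ : ∀ {i j l} → Acc _<_ (toℕ l) → W i → W j → W l → toℕ i < toℕ j → toℕ j ≤ toℕ l
         → arc T i j ≡ arc T i l
  slideʳ {i} {j} {l} (acc smaller) wi wj wl i<j j≤l with toℕ j ℕ.≟ toℕ l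
  ... | yes j≡l = cong (arc T i) (toℕ-injective j≡l)
  ... | no j≢l with predecessor wj wl (≤∧≢⇒< j≤l j≢l)
  ... | l' , wl' , l≡2+l' , j≤l' =
    trans (slideʳ (smaller (<2+ l≡2+l')) wi wj wl' i<j j≤l')
          (twinsˡ wl' wl wi l≡2+l' (<⇒≢ (<-≤-trans i<j j≤l')) (<⇒≢ (<-≤-trans i<j j≤l)))

  slideˡ : ∀ {i k l} → Acc _<_ (toℕ k) → W i → W k → W l → toℕ i ≤ toℕ k → toℕ k < toℕ l
         → arc T i l ≡ arc T k l
  slideˡ {i} {k} {l} (acc smaller) wi wk wl i≤k k<l with toℕ i ℕ.≟ toℕ k
  ... | yes i≡k = cong (λ v → arc T v l) (toℕ-injective i≡k)
  ... | no i≢k with predecessor wi wk (≤∧≢⇒< i≤k i≢k)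
  ... | k' , wk' , k≡2+k' , i≤k' =
    trans (slideˡ (smaller (<2+ k≡2+k')) wi wk' wl i≤k' k'<l)
          (twins wk' wk wl k≡2+k' (≢-sym (<⇒≢ k'<l)) (≢-sym (<⇒≢ k<l)))
    where k'<l = <-trans (<2+ k≡2+k') k<l

  same-head : ∀ {i k l} → W i → W k → W l → toℕ i < toℕ l → toℕ k < toℕ l
            → arc T i l ≡ arc T k l
  same-head {i} {k} wi wk wl i<l k<l with ≤-total (toℕ i) (toℕ k)
  ... | inj₁ i≤k = slideˡ (<-wellFounded _) wi wk wl i≤k k<l
  ... | inj₂ k≤i = sym (slideˡ (<-wellFounded _) wk wi wl k≤i i<l)

  arcs-constant : ∀ {i j k l} → W i → W j → W k → W l → toℕ i < toℕ j → toℕ k < toℕ l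
                → arc T i j ≡ arc T k l
  arcs-constant {j = j} {l = l} wi wj wk wl i<j k<l with ≤-total (toℕ j) (toℕ l)
  ... | inj₁ j≤l = trans (slideʳ (<-wellFounded _) wi wj wl i<j j≤l)
                         (same-head wi wk wl (<-≤-trans i<j j≤l) k<l)
  ... | inj₂ l≤j = trans (same-head wi wk wj i<j (<-≤-trans k<l l≤j))
                         (sym (slideʳ (<-wellFounded _) wk wl wj k<l l≤j))

arcs-constant⇒totalOrderOrDual : ∀ {n} (T : Tournament n) {W : Fin n → Set} → Decidable W
  → (∀ {i j k l} → W i → W j → W k → W l → toℕ i < toℕ j → toℕ k < toℕ l
     → arc T i j ≡ arc T k l)
  → TotalOrderOrDual T W
arcs-constant⇒totalOrderOrDual T W? constant
  with any? (λ i → any? (λ j → W? i ×-dec W? j ×-dec toℕ i <? toℕ j ×-dec arc T i j Bool.≟ false))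
... | yes (i , j , wi , wj , i<j , i↛j) = inj₂ λ k l wk wl k<l → begin
  arc T l k        ≡⟨ tourn T l k (≢-sym (<⇒≢ k<l)) ⟩
  not (arc T k l)  ≡⟨ cong not (constant wk wl wi wj k<l i<j) ⟩
  not (arc T i j)  ≡⟨ cong not i↛j ⟩
  true             ∎
  where open ≡-Reasoning
... | no none = inj₁ λ i j wi wj i<j → Bool.¬-not λ i↛j → none (i , j , wi , wj , i<j , i↛j)

module _ {n m : ℕ} {a : Fin n} {par : ℕ} where

  block-bounded : ∀ above {i} → Block m a above par i → toℕ i ≤ m
  block-bounded true (i≤m , _) = i≤m
  block-bounded false (i≤m , _) = i≤m

  block-parity : ∀ above {i j} → Block m a above par i → Block m a above par j
    → toℕ i % 2 ≡ toℕ j % 2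
  block-parity true (_ , _ , i%2) (_ , _ , j%2) = trans i%2 (sym j%2)
  block-parity false (_ , _ , i%2) (_ , _ , j%2) = trans i%2 (sym j%2)

  block-convex : ∀ above {i j k} → Block m a above par i → Block m a above par k
    → toℕ i ≤ toℕ j → toℕ j ≤ toℕ k → toℕ j % 2 ≡ toℕ i % 2 → Block m a above par j
  block-convex true (_ , a<i , i%2) (k≤m , _) i≤j j≤k j≡i =
    ≤-trans j≤k k≤m , <-≤-trans a<i i≤j , trans j≡i i%2
  block-convex false (_ , _ , i%2) (k≤m , k<a , _) i≤j j≤k j≡i =
    ≤-trans j≤k k≤m , ≤-<-trans j≤k k<a , trans j≡i i%2

  block-between≢a : ∀ above {i j x} → Block m a above par i → Block m a above par j
    → toℕ i < toℕ x → toℕ x < toℕ j → x ≢ a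
  block-between≢a true (_ , a<i , _) _ i<x _ = ≢-sym (<⇒≢ (<-trans a<i i<x))
  block-between≢a false _ (_ , j<a , _) _ x<j = <⇒≢ (<-trans x<j j<a)

  block? : ∀ above → Decidable (Block m a above par)
  block? true i = toℕ i ≤? m ×-dec toℕ a <? toℕ i ×-dec toℕ i % 2 ℕ.≟ par
  block? false i = toℕ i ≤? m ×-dec toℕ i <? toℕ a ×-dec toℕ i % 2 ℕ.≟ par

block-twins : ∀ {n m} (T : Tournament n) {a : Fin n} → 5 ≤ n → (∀ x → x ≢ a → Critical T x)
  → (∀ x y → InC m x → InC m y → toℕ y ≡ suc (toℕ x) → IAdj T x y)
  → ∀ above {par i j w}
  → Block m a above par i → Block m a above par j → Block m a above par w
  → toℕ j ≡ 2 + toℕ i → w ≢ i → w ≢ j → arc T i w ≡ arc T j w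
block-twins T 5≤n critical path-edge above {i = i} {j} {w} bi bj bw j≡2+i w≢i w≢j =
  critical-twins T 5≤n (proj₂ (critical x x≢a))
    (path-edge i x (block-bounded above bi) x≤m x≡1+i)
    (path-edge x j x≤m (block-bounded above bj) (trans j≡2+i (cong suc (sym x≡1+i))))
    (<⇒≢ (<-trans i<x x<j)) w≢i w≢x w≢j
  where
  1+i<n : suc (toℕ i) < _
  1+i<n = <-trans (subst (suc (toℕ i) <_) (sym j≡2+i) (n<1+n _)) (toℕ<n j)
  x = fromℕ< 1+i<n
  x≡1+i : toℕ x ≡ suc (toℕ i)
  x≡1+i = toℕ-fromℕ< 1+i<n
  i<x : toℕ i < toℕ x
  i<x = subst (toℕ i <_) (sym x≡1+i) (n<1+n _)
  x<j : toℕ x < toℕ j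
  x<j = subst₂ _<_ (sym x≡1+i) (sym j≡2+i) (n<1+n _)
  x≤m = <⇒≤ (<-≤-trans x<j (block-bounded above bj))
  x≢a = block-between≢a above bi bj i<x x<j
  w≢x : w ≢ x
  w≢x w≡x = suc-%2≢ (toℕ i)
    (trans (cong (_% 2) (sym x≡1+i))
           (trans (cong (λ v → toℕ v % 2) (sym w≡x)) (block-parity above bw bi)))

lemma4p3 : {n m : ℕ} (T : Tournament n) (a : Fin n)
    → MinusOneCritical T a
    → 1 ≤ m → m < n
    → (∀ x y → InC m x → InC m y → IAdj T x y → toℕ y ≡ suc (toℕ x) ⊎ toℕ x ≡ suc (toℕ y))
    → (∀ x y → InC m x → InC m y → toℕ y ≡ suc (toℕ x) → IAdj T x y)
    → (∀ x y → InC m x → ¬ InC m y → ¬ IAdj T x y)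
    → InC m a
    → (above : Bool) (par : ℕ) → par < 2
    → TotalOrderOrDual T (Block m a above par)
-- Of the description of I(T) only the edges between consecutive vertices of C are needed.
lemma4p3 T _ (5≤n , _ , _ , critical) _ _ _ path-edge _ _ above _ _ =
  arcs-constant⇒totalOrderOrDual T (block? above)
    (StepTwoChain.arcs-constant T (block-parity above) (block-convex above)
      (block-twins T 5≤n critical path-edge above))
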